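{- Let $d\geq3$ and let $F$ be a locally sparse $d$-regular graph on $[n]$. For any pair of adjacent vertices $x,y$ of $F$ and every $3\leq v\leq n-3$, there are at most two closed subgraphs of $F$ on $v$ vertices that contain $x$ and do not contain $y$.
   Context: For $\tilde F\subset F$, a vertex of $\tilde F$ is boundary if its degree in $\tilde F$ is less than $d$; the edge boundary $\partial_e(\tilde F)$ is the set of edges of $F$ between boundary vertices of $\tilde F$ and $V(F)\setminus V(\tilde F)$. $F$ is locally sparse if every subgraph $\tilde F\subset F$ with $3\leq|V(\tilde F)|\leq n-3$ has $|\partial_e(\tilde F)|\geq d+1$. Let $\Delta=d+1$ if $d$ is odd and $\Delta=d+2$ if $d$ is even. A closed subgraph of $F$ is an induced subgraph of $F$ whose edge boundary has size exactly $\Delta$. -}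

module Defs where

open import Data.Bool using (Bool; true; false; _∧_; not; if_then_else_)
open import Data.Nat using (ℕ; zero; suc; _+_; _<ᵇ_; _%_)
open import Data.Fin using (Fin)
open import Data.List using (List; map; allFin)
open import Data.Nat.ListAction using (sum)
open import Data.Vec using (tabulate; lookup)
open import Data.Fin.Subset using (Subset; ∣_∣)
open import Relation.Binary.PropositionalEquality using (_≡_)

record Graph (n : ℕ) : Set where
  field
    adj    : Fin n → Fin n → Bool
    sym    : ∀ x y → adj x y ≡ adj y x
    irrefl : ∀ x → adj x x ≡ false
open Graph public

count : ∀ {n} → (Fin n → Bool) → ℕ
count P = ∣ tabulate P ∣

degree : ∀ {n} → Graph n → Fin n → ℕ
degree F x = count (adj F x)

Regular : ∀ {n} → ℕ → Graph n → Set
Regular d F = ∀ x → degree F x ≡ d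

record Subgraph {n : ℕ} (F : Graph n) : Set where
  field
    vs      : Subset n
    es      : Fin n → Fin n → Bool
    es-sym  : ∀ x y → es x y ≡ es y x
    es-adj  : ∀ x y → es x y ≡ true → adj F x y ≡ true
    es-vsˡ  : ∀ x y → es x y ≡ true → lookup vs x ≡ true
open Subgraph public

nVerts : ∀ {n} {F : Graph n} → Subgraph F → ℕ
nVerts H = ∣ vs H ∣

subDegree : ∀ {n} {F : Graph n} → Subgraph F → Fin n → ℕ
subDegree H x = count (es H x)

isBoundary : ∀ {n} {F : Graph n} → ℕ → Subgraph F → Fin n → Bool
isBoundary d H x = lookup (vs H) x ∧ (subDegree H x <ᵇ d)

-- |∂_e(F̃)|: number of edges of F between a boundary vertex of F̃ and a
-- vertex of V(F) \ V(F̃).  (Each such edge has exactly one end in V(F̃),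
-- so counting ordered pairs (x , y) with x boundary, y ∉ V(F̃) counts each once.)
edgeBoundarySize : ∀ {n} (F : Graph n) → ℕ → Subgraph F → ℕ
edgeBoundarySize {n} F d H =
  sum (map (λ x → if isBoundary d H x
                    then count (λ y → adj F x y ∧ not (lookup (vs H) y))
                    else 0)
           (allFin n))

LocallySparse : ∀ {n} → ℕ → Graph n → Set
LocallySparse {n} d F =
  (H : Subgraph F) → 3 Data.Nat.≤ nVerts H → nVerts H Data.Nat.≤ n Data.Nat.∸ 3 →
  suc d Data.Nat.≤ edgeBoundarySize F d H

induced : ∀ {n} (F : Graph n) → Subset n → Subgraph F
induced F S = record
  { vs = S
  ; es = λ x y → lookup S x ∧ lookup S y ∧ adj F x y
  ; es-sym = λ x y → lem x y
  ; es-adj = λ x y e → adjOf x y e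
  ; es-vsˡ = λ x y e → vsOf x y e
  }
  where
  open import Relation.Binary.PropositionalEquality using (refl; cong₂)
  lem : ∀ x y → (lookup S x ∧ lookup S y ∧ adj F x y) ≡ (lookup S y ∧ lookup S x ∧ adj F y x)
  lem x y with lookup S x | lookup S y
  ... | true  | true  = sym F x y
  ... | true  | false = refl
  ... | false | true  = refl
  ... | false | false = refl
  adjOf : ∀ x y → (lookup S x ∧ lookup S y ∧ adj F x y) ≡ true → adj F x y ≡ true
  adjOf x y e with lookup S x | lookup S y
  ... | true | true = e
  adjOf x y () | true | false
  adjOf x y () | false | _
  vsOf : ∀ x y → (lookup S x ∧ lookup S y ∧ adj F x y) ≡ true → lookup S x ≡ true
  vsOf x y e with lookup S x
  ... | true = refl
  vsOf x y () | false

Δ : ℕ → ℕ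
Δ d with d % 2
... | zero = d + 2
... | suc _ = d + 1

Closed : ∀ {n} (F : Graph n) → ℕ → Subset n → Set
Closed F d S = edgeBoundarySize F d (induced F S) ≡ Δ d

{-# OPTIONS --safe #-}
-- Write e(X, Y) for the number of edges between X and Y and ∂X = e(X, ∁X); the edge boundary of
-- the subgraph induced on S is ∂S. The cut function satisfies the posimodular identity
-- ∂A + ∂B = ∂(A ∖ B) + ∂(B ∖ A) + 2 e(A ∩ B, ∁(A ∪ B)), and local sparsity gives ∂X ≥ Δ whenever
-- 2 ≤ |X| ≤ n - 3 (for even d because ∂X ≡ d |X| (mod 2)). For two distinct closed sets A, B of
-- size v containing x but not y, the edge xy makes the last term positive, which forces
-- |A ∖ B| = 1 and then Δ = d + e(A ∩ B, ∁(A ∪ B)); splitting off the vertex of A ∖ B shows that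
-- it has at least two neighbours in A ∩ B. Counting Venn regions, three such sets form a
-- sunflower, or their complements (which are closed as well) do, and in a sunflower these facts
-- give e(A ∩ B, ∁(A ∪ B)) ≥ 3 > Δ - d.
module Submission where

open import Defs
open import Data.Bool using (true; false)
open import Data.Nat using (ℕ; _≤_; _∸_)
open import Data.Fin using (Fin)
open import Data.Vec using (lookup)
open import Data.Fin.Subset using (Subset; ∣_∣)
open import Data.Empty using (⊥)
open import Relation.Binary.PropositionalEquality using (_≡_; _≢_)

open import Algebra.Bundles using (CommutativeMonoid)
open import Data.Bool using (Bool; not; _∧_; _∨_; if_then_else_; T)
open import Data.Bool.Properties
  using (∧-comm; ∧-identityʳ; ∧-zeroʳ; not-involutive; not-injective; ∧-commutativeMonoid)
open import Algebra.Properties.CommutativeSemigroup (CommutativeMonoid.commutativeSemigroup ∧-commutativeMonoid)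
  using (x∙yz≈z∙yx; xy∙z≈xz∙y; xy∙z≈zx∙y)
open import Data.Fin using (zero; suc)
import Data.List as List hiding (sum)
open import Data.List.Properties using (map-tabulate)
import Data.Nat.ListAction as List
open import Data.Nat using (zero; suc; _+_; _*_; _<_; _%_; _<ᵇ_; _≤?_; z≤n; s≤s)
open import Data.Nat.Divisibility using (_∣_; divides; m∣m*n; ∣m∣n⇒∣m+n; ∣m+n∣m⇒∣n; ∣m⇒∣m*n; m%n≡0⇒n∣m)
open import Data.Nat.Properties
open import Algebra.Properties.Semiring.Sum +-*-semiring
  using (sum; sum-syntax; ∑-distrib-+; ∑-comm; sum-cong-≗; sum-replicate-zero; *-distribʳ-sum)
open import Data.Nat.Tactic.RingSolver using (solve-∀)
open import Data.Product using (_×_; _,_; proj₁; proj₂)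
open import Data.Sum using (_⊎_; inj₁; inj₂; [_,_]) renaming (map to ⊎-map)
open import Data.Vec using ([]; _∷_; tabulate)
open import Data.Vec.Properties using (lookup∘tabulate; tabulate∘lookup; tabulate-cong)
open import Function using (_∘_)
open import Relation.Binary.PropositionalEquality
  using (refl; trans; cong; cong₂; subst; subst₂; _≗_; module ≡-Reasoning)
import Relation.Binary.PropositionalEquality as ≡
open import Relation.Nullary using (¬_; yes; no; contradiction)

⟦_⟧ : Bool → ℕ
⟦ true ⟧  = 1
⟦ false ⟧ = 0

⟦⟧-split : ∀ a b → ⟦ a ⟧ ≡ ⟦ a ∧ b ⟧ + ⟦ a ∧ not b ⟧
⟦⟧-split true  true  = refl
⟦⟧-split true  false = refl
⟦⟧-split false _     = refl

∑-mono-≤ : ∀ {n} {f g : Fin n → ℕ} → (∀ i → f i ≤ g i) → sum f ≤ sum g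
∑-mono-≤ {zero}  f≤g = z≤n
∑-mono-≤ {suc n} f≤g = +-mono-≤ (f≤g zero) (∑-mono-≤ (f≤g ∘ suc))

≤-∑ : ∀ {n} (f : Fin n → ℕ) i → f i ≤ sum f
≤-∑ f zero    = m≤m+n (f zero) _
≤-∑ f (suc i) = ≤-trans (≤-∑ (f ∘ suc) i) (m≤n+m _ (f zero))

sum-map-allFin : ∀ {n} (f : Fin n → ℕ) → List.sum (List.map f (List.allFin n)) ≡ sum f
sum-map-allFin f = trans (cong List.sum (map-tabulate (λ i → i) f)) (sum-tabulate f)
  where
  sum-tabulate : ∀ {n} (f : Fin n → ℕ) → List.sum (List.tabulate f) ≡ sum f
  sum-tabulate {zero}  f = refl
  sum-tabulate {suc n} f = cong (f zero +_) (sum-tabulate (f ∘ suc))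

2∣∑∑-symmetric : ∀ {m} (g : Fin m → Fin m → ℕ) → (∀ x y → g x y ≡ g y x) → (∀ x → g x x ≡ 0) →
                 2 ∣ ∑[ x < m ] ∑[ y < m ] g x y
2∣∑∑-symmetric {zero}  g g-sym g-diag = divides 0 refl
2∣∑∑-symmetric {suc m} g g-sym g-diag =
  subst (2 ∣_) (≡.sym first-row-and-column)
        (∣m∣n⇒∣m+n (m∣m*n r) (2∣∑∑-symmetric g′ (λ x y → g-sym (suc x) (suc y)) (g-diag ∘ suc)))
  where
  open ≡-Reasoning
  g′ : Fin m → Fin m → ℕ
  g′ x y = g (suc x) (suc y)
  r rest : ℕ
  r    = ∑[ y < m ] g zero (suc y)
  rest = ∑[ x < m ] ∑[ y < m ] g′ x y
  first-row-and-column : ∑[ x < suc m ] ∑[ y < suc m ] g x y ≡ 2 * r + rest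
  first-row-and-column = begin
    (g zero zero + r) + ∑[ x < m ] (g (suc x) zero + ∑[ y < m ] g′ x y)
      ≡⟨ cong₂ _+_ (cong (_+ r) (g-diag zero)) (∑-distrib-+ (λ x → g (suc x) zero) (λ x → ∑[ y < m ] g′ x y)) ⟩
    r + (∑[ x < m ] g (suc x) zero + rest)
      ≡⟨ cong (λ c → r + (c + rest)) (sum-cong-≗ (λ x → g-sym (suc x) zero)) ⟩
    r + (r + rest)
      ≡⟨ +-assoc r r rest ⟨
    r + r + rest
      ≡⟨ cong (λ k → r + k + rest) (+-identityʳ r) ⟨
    2 * r + rest
      ∎

VertexSet : ℕ → Set
VertexSet n = Fin n → Bool

module _ {n : ℕ} where

  infixr 7 _∩_ _∖_
  infixr 6 _∪_
  infix 4 _⊆_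

  ∁ : VertexSet n → VertexSet n
  ∁ X i = not (X i)

  _∩_ _∪_ _∖_ : VertexSet n → VertexSet n → VertexSet n
  (X ∩ Y) i = X i ∧ Y i
  (X ∪ Y) i = X i ∨ Y i
  (X ∖ Y) i = X i ∧ not (Y i)

  _⊆_ : VertexSet n → VertexSet n → Set
  X ⊆ Y = ∀ {i} → X i ≡ true → Y i ≡ true

  size : VertexSet n → ℕ
  size X = ∑[ i < n ] ⟦ X i ⟧

  ⊆-antisym : {X Y : VertexSet n} → X ⊆ Y → Y ⊆ X → X ≗ Y
  ⊆-antisym {X} {Y} X⊆Y Y⊆X i with X i in Xi | Y i in Yi
  ... | true  | true  = refl
  ... | false | false = refl
  ... | true  | false = contradiction (trans (≡.sym Yi) (X⊆Y Xi)) λ ()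
  ... | false | true  = contradiction (trans (≡.sym Xi) (Y⊆X Yi)) λ ()

  ≉-sym : {X Y : VertexSet n} → ¬ X ≗ Y → ¬ Y ≗ X
  ≉-sym X≉Y Y≗X = X≉Y (≡.sym ∘ Y≗X)

  ∁-≉ : {X Y : VertexSet n} → ¬ X ≗ Y → ¬ ∁ X ≗ ∁ Y
  ∁-≉ X≉Y ∁X≗∁Y = X≉Y (not-injective ∘ ∁X≗∁Y)

  size-cong : {X Y : VertexSet n} → X ≗ Y → size X ≡ size Y
  size-cong X≗Y = sum-cong-≗ (cong ⟦_⟧ ∘ X≗Y)

  size-split : (X Y : VertexSet n) → size X ≡ size (X ∩ Y) + size (X ∖ Y)
  size-split X Y = trans (sum-cong-≗ (λ i → ⟦⟧-split (X i) (Y i)))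
                         (∑-distrib-+ (⟦_⟧ ∘ (X ∩ Y)) (⟦_⟧ ∘ (X ∖ Y)))

  size-∁ : (X : VertexSet n) → size (∁ X) ≡ n ∸ size X
  size-∁ X = begin
    size (∁ X)                       ≡⟨ m+n∸m≡n (size X) (size (∁ X)) ⟨
    size X + size (∁ X) ∸ size X     ≡⟨ cong (_∸ size X) (size-split (λ _ → true) X) ⟨
    ∑[ i < n ] ⟦ true ⟧ ∸ size X     ≡⟨ cong (_∸ size X) (size-all n) ⟨
    n ∸ size X                       ∎
    where
    open ≡-Reasoning
    size-all : ∀ m → m ≡ ∑[ i < m ] ⟦ true ⟧
    size-all zero    = refl
    size-all (suc m) = cong suc (size-all m)

  size∖≤size : (X Y : VertexSet n) → size (X ∖ Y) ≤ size X
  size∖≤size X Y = subst (size (X ∖ Y) ≤_) (≡.sym (size-split X Y)) (m≤n+m _ _)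

  size∖-swap : (X Y : VertexSet n) → size X ≡ size Y → size (X ∖ Y) ≡ size (Y ∖ X)
  size∖-swap X Y |X|≡|Y| = +-cancelˡ-≡ (size (X ∩ Y)) _ _ (begin
    size (X ∩ Y) + size (X ∖ Y)   ≡⟨ size-split X Y ⟨
    size X                        ≡⟨ |X|≡|Y| ⟩
    size Y                        ≡⟨ size-split Y X ⟩
    size (Y ∩ X) + size (Y ∖ X)   ≡⟨ cong (_+ size (Y ∖ X)) (size-cong (λ i → ∧-comm (Y i) (X i))) ⟩
    size (X ∩ Y) + size (Y ∖ X)   ∎)
    where open ≡-Reasoning

  ∈⇒1≤size : (X : VertexSet n) {i : Fin n} → X i ≡ true → 1 ≤ size X
  ∈⇒1≤size X {i} Xi = subst (_≤ size X) (cong ⟦_⟧ Xi) (≤-∑ (⟦_⟧ ∘ X) i)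

  size∖≡0⇒⊆ : (X Y : VertexSet n) → size (X ∖ Y) ≡ 0 → X ⊆ Y
  size∖≡0⇒⊆ X Y |X∖Y|≡0 {i} Xi with Y i in Yi
  ... | true  = refl
  ... | false = contradiction (subst (1 ≤_) |X∖Y|≡0 (∈⇒1≤size (X ∖ Y) (cong₂ (λ a b → a ∧ not b) Xi Yi))) λ ()

  size∖≡0⇒≗ : (X Y : VertexSet n) → size X ≡ size Y → size (X ∖ Y) ≡ 0 → X ≗ Y
  size∖≡0⇒≗ X Y |X|≡|Y| |X∖Y|≡0 =
    ⊆-antisym (size∖≡0⇒⊆ X Y |X∖Y|≡0) (size∖≡0⇒⊆ Y X (trans (≡.sym (size∖-swap X Y |X|≡|Y|)) |X∖Y|≡0))

  Sunflower : VertexSet n → VertexSet n → VertexSet n → Set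
  Sunflower A B C = A ∩ B ⊆ C × B ∩ C ⊆ A × C ∩ A ⊆ B

  ∖-regions : (A B C : VertexSet n) →
              size (A ∖ B) ≡ size ((C ∩ A) ∖ B) + size ((A ∖ B) ∖ C) ×
              size (A ∖ C) ≡ size ((A ∩ B) ∖ C) + size ((A ∖ B) ∖ C)
  ∖-regions A B C =
    trans (size-split (A ∖ B) C)
          (cong (_+ size ((A ∖ B) ∖ C)) (size-cong (λ i → xy∙z≈zx∙y (A i) (not (B i)) (C i)))) ,
    trans (size-split (A ∖ C) B) (cong₂ _+_ (size-cong (λ i → xy∙z≈xz∙y (A i) (not (C i)) (B i)))
                                            (size-cong (λ i → xy∙z≈xz∙y (A i) (not (C i)) (not (B i)))))

∣∣≡size : ∀ {n} (S : Subset n) → ∣ S ∣ ≡ size (lookup S)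
∣∣≡size []          = refl
∣∣≡size (true ∷ S)  = cong suc (∣∣≡size S)
∣∣≡size (false ∷ S) = ∣∣≡size S

count≡size : ∀ {n} (P : VertexSet n) → count P ≡ size P
count≡size P = trans (∣∣≡size (tabulate P)) (size-cong (lookup∘tabulate P))

≢⇒≉ : ∀ {n} {S S′ : Subset n} → S ≢ S′ → ¬ lookup S ≗ lookup S′
≢⇒≉ {S = S} {S′} S≢S′ S≗S′ =
  S≢S′ (trans (≡.sym (tabulate∘lookup S)) (trans (tabulate-cong S≗S′) (tabulate∘lookup S′)))

-- a, b, c count the vertices lying in exactly one of three sets, ab, bc, ca those in exactly two.
venn-dichotomy : ∀ {a b c ab bc ca} →
                 ca + a ≡ 1 → ab + a ≡ 1 → ab + b ≡ 1 → bc + b ≡ 1 → bc + c ≡ 1 → ca + c ≡ 1 →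
                 (ab ≡ 0 × bc ≡ 0 × ca ≡ 0) ⊎ (a ≡ 0 × b ≡ 0 × c ≡ 0)
venn-dichotomy {ab = zero} {bc} {ca} ca+1≡1 refl refl bc+1≡1 _ _ =
  inj₁ (refl , +-cancelʳ-≡ 1 bc 0 bc+1≡1 , +-cancelʳ-≡ 1 ca 0 ca+1≡1)
venn-dichotomy {c = c} {ab = suc zero} {bc} _ refl refl bc+0≡1 bc+c≡1 _ =
  inj₂ (refl , refl , suc-injective (subst (λ k → k + c ≡ 1) bc≡1 bc+c≡1))
  where
  bc≡1 : bc ≡ 1
  bc≡1 = trans (≡.sym (+-identityʳ bc)) bc+0≡1
venn-dichotomy {ab = suc (suc _)} _ () _ _ _ _

-- Sunflower (∁ A) (∁ B) (∁ C) says that no vertex lies in exactly one of A, B, C.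
sunflower-or-cosunflower : ∀ {n} (A B C : VertexSet n) →
  size (A ∖ B) ≡ 1 → size (A ∖ C) ≡ 1 → size (B ∖ C) ≡ 1 →
  size (B ∖ A) ≡ 1 → size (C ∖ A) ≡ 1 → size (C ∖ B) ≡ 1 →
  Sunflower A B C ⊎ Sunflower (∁ A) (∁ B) (∁ C)
sunflower-or-cosunflower {n} A B C |A∖B| |A∖C| |B∖C| |B∖A| |C∖A| |C∖B| =
  ⊎-map sunflower cosunflower
    (venn-dichotomy (regions₁ A B C |A∖B|) (regions₂ A B C |A∖C|) (regions₁ B C A |B∖C|)
                    (regions₂ B C A |B∖A|) (regions₁ C A B |C∖A|) (regions₂ C A B |C∖B|))
  where
  regions₁ : (X Y Z : VertexSet n) → size (X ∖ Y) ≡ 1 → size ((Z ∩ X) ∖ Y) + size ((X ∖ Y) ∖ Z) ≡ 1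
  regions₁ X Y Z = trans (≡.sym (proj₁ (∖-regions X Y Z)))
  regions₂ : (X Y Z : VertexSet n) → size (X ∖ Z) ≡ 1 → size ((X ∩ Y) ∖ Z) + size ((X ∖ Y) ∖ Z) ≡ 1
  regions₂ X Y Z = trans (≡.sym (proj₂ (∖-regions X Y Z)))
  sunflower : size ((A ∩ B) ∖ C) ≡ 0 × size ((B ∩ C) ∖ A) ≡ 0 × size ((C ∩ A) ∖ B) ≡ 0 → Sunflower A B C
  sunflower (ab≡0 , bc≡0 , ca≡0) = size∖≡0⇒⊆ (A ∩ B) C ab≡0 , size∖≡0⇒⊆ (B ∩ C) A bc≡0 , size∖≡0⇒⊆ (C ∩ A) B ca≡0
  ∖⊆⇒∁∩∁⊆∁ : (X Y Z : VertexSet n) → X ∖ Y ⊆ Z → ∁ Y ∩ ∁ Z ⊆ ∁ X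
  ∖⊆⇒∁∩∁⊆∁ X Y Z X∖Y⊆Z {i} = pointwise (X i) (Y i) (Z i) (X∖Y⊆Z {i})
    where
    pointwise : ∀ a b c → (a ∧ not b ≡ true → c ≡ true) → not b ∧ not c ≡ true → not a ≡ true
    pointwise false b     c     _ _  = refl
    pointwise true  false false h _  = h refl
    pointwise true  false true  _ ()
    pointwise true  true  c     _ ()
  cosunflower : size ((A ∖ B) ∖ C) ≡ 0 × size ((B ∖ C) ∖ A) ≡ 0 × size ((C ∖ A) ∖ B) ≡ 0 →
                Sunflower (∁ A) (∁ B) (∁ C)
  cosunflower (a≡0 , b≡0 , c≡0) =
    ∖⊆⇒∁∩∁⊆∁ C A B (size∖≡0⇒⊆ (C ∖ A) B c≡0) ,
    ∖⊆⇒∁∩∁⊆∁ A B C (size∖≡0⇒⊆ (A ∖ B) C a≡0) ,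
    ∖⊆⇒∁∩∁⊆∁ B C A (size∖≡0⇒⊆ (B ∖ C) A b≡0)

not[a∧b]∧a : ∀ a b → not (a ∧ b) ∧ a ≡ a ∧ not b
not[a∧b]∧a true  b = ∧-identityʳ (not b)
not[a∧b]∧a false b = refl

not[a∧b]∧not[a] : ∀ a b → not (a ∧ b) ∧ not a ≡ not a
not[a∧b]∧not[a] true  b = ∧-zeroʳ (not b)
not[a∧b]∧not[a] false b = refl

not[a∧not[b]]∧a : ∀ a b → not (a ∧ not b) ∧ a ≡ a ∧ b
not[a∧not[b]]∧a a b = trans (not[a∧b]∧a a (not b)) (cong (a ∧_) (not-involutive b))

not[a]∧not[b] : ∀ a b → not a ∧ not b ≡ not (a ∨ b)
not[a]∧not[b] true  b = refl
not[a]∧not[b] false b = refl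

module Edges {n : ℕ} (F : Graph n) where

  degreeIn : VertexSet n → Fin n → ℕ
  degreeIn Y x = size (λ y → adj F x y ∧ Y y)

  -- Ordered pairs are counted, so e X X is twice the number of edges inside X.
  e : VertexSet n → VertexSet n → ℕ
  e X Y = ∑[ x < n ] ∑[ y < n ] ⟦ X x ∧ adj F x y ∧ Y y ⟧

  e-cong : ∀ {X X′ Y Y′} → X ≗ X′ → Y ≗ Y′ → e X Y ≡ e X′ Y′
  e-cong X≗X′ Y≗Y′ =
    sum-cong-≗ λ x → sum-cong-≗ λ y → cong₂ (λ a b → ⟦ a ∧ adj F x y ∧ b ⟧) (X≗X′ x) (Y≗Y′ y)

  e-congʳ : ∀ X {Y Y′} → Y ≗ Y′ → e X Y ≡ e X Y′
  e-congʳ X = e-cong {X} (λ _ → refl)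

  edge-reverse : (X Y : VertexSet n) (x y : Fin n) → X x ∧ adj F x y ∧ Y y ≡ Y y ∧ adj F y x ∧ X x
  edge-reverse X Y x y = trans (x∙yz≈z∙yx (X x) (adj F x y) (Y y)) (cong (λ b → Y y ∧ b ∧ X x) (sym F x y))

  e-comm : ∀ X Y → e X Y ≡ e Y X
  e-comm X Y = trans (∑-comm (λ x y → ⟦ X x ∧ adj F x y ∧ Y y ⟧))
                     (sum-cong-≗ λ y → sum-cong-≗ λ x → cong ⟦_⟧ (edge-reverse X Y x y))

  e-splitʳ : ∀ X Y Z → e X Y ≡ e X (Y ∩ Z) + e X (Y ∖ Z)
  e-splitʳ X Y Z =
    trans (sum-cong-≗ λ x → trans (sum-cong-≗ (λ y → split (X x) (adj F x y) (Y y) (Z y)))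
                                  (∑-distrib-+ (term (Y ∩ Z) x) (term (Y ∖ Z) x)))
          (∑-distrib-+ (λ x → ∑[ y < n ] term (Y ∩ Z) x y) (λ x → ∑[ y < n ] term (Y ∖ Z) x y))
    where
    term : VertexSet n → Fin n → Fin n → ℕ
    term W x y = ⟦ X x ∧ adj F x y ∧ W y ⟧
    split : ∀ a b c z → ⟦ a ∧ b ∧ c ⟧ ≡ ⟦ a ∧ b ∧ c ∧ z ⟧ + ⟦ a ∧ b ∧ c ∧ not z ⟧
    split true  true  c z = ⟦⟧-split c z
    split true  false _ _ = refl
    split false _     _ _ = refl

  e-splitˡ : ∀ X Y Z → e X Z ≡ e (X ∩ Y) Z + e (X ∖ Y) Z
  e-splitˡ X Y Z = begin
    e X Z                            ≡⟨ e-comm X Z ⟩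
    e Z X                            ≡⟨ e-splitʳ Z X Y ⟩
    e Z (X ∩ Y) + e Z (X ∖ Y)        ≡⟨ cong₂ _+_ (e-comm Z (X ∩ Y)) (e-comm Z (X ∖ Y)) ⟩
    e (X ∩ Y) Z + e (X ∖ Y) Z        ∎
    where open ≡-Reasoning

  e-by-rows : ∀ X Y → e X Y ≡ ∑[ x < n ] (⟦ X x ⟧ * degreeIn Y x)
  e-by-rows X Y = sum-cong-≗ row
    where
    row : ∀ x → ∑[ y < n ] ⟦ X x ∧ adj F x y ∧ Y y ⟧ ≡ ⟦ X x ⟧ * degreeIn Y x
    row x with X x
    ... | true  = ≡.sym (+-identityʳ _)
    ... | false = sum-replicate-zero n

  e-positive : ∀ X Y {x y} → X x ≡ true → adj F x y ≡ true → Y y ≡ true → 1 ≤ e X Y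
  e-positive X Y {x} {y} Xx xy Yy = begin
    1                                      ≡⟨ cong ⟦_⟧ (cong₂ _∧_ Xx (cong₂ _∧_ xy Yy)) ⟨
    ⟦ X x ∧ adj F x y ∧ Y y ⟧              ≤⟨ ≤-∑ (λ y → ⟦ X x ∧ adj F x y ∧ Y y ⟧) y ⟩
    ∑[ y < n ] ⟦ X x ∧ adj F x y ∧ Y y ⟧   ≤⟨ ≤-∑ (λ x → ∑[ y < n ] ⟦ X x ∧ adj F x y ∧ Y y ⟧) x ⟩
    e X Y                                  ∎
    where open ≤-Reasoning

  degreeIn<size : ∀ X {x} → X x ≡ true → degreeIn X x < size X
  degreeIn<size X {x} Xx = begin-strict
    degreeIn X x                                ≡⟨ size-cong (λ y → ∧-comm (adj F x y) (X y)) ⟩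
    size (X ∩ adj F x)                          <⟨ m<m+n _ (∈⇒1≤size (X ∖ adj F x) x∈X∖N[x]) ⟩
    size (X ∩ adj F x) + size (X ∖ adj F x)     ≡⟨ size-split X (adj F x) ⟨
    size X                                      ∎
    where
    open ≤-Reasoning
    x∈X∖N[x] : X x ∧ not (adj F x x) ≡ true
    x∈X∖N[x] = cong₂ (λ a b → a ∧ not b) Xx (irrefl F x)

  e-self-bound : ∀ X → e X X ≤ size X * (size X ∸ 1)
  e-self-bound X = begin
    e X X                                    ≡⟨ e-by-rows X X ⟩
    ∑[ x < n ] (⟦ X x ⟧ * degreeIn X x)      ≤⟨ ∑-mono-≤ row ⟩
    ∑[ x < n ] (⟦ X x ⟧ * (size X ∸ 1))      ≡⟨ *-distribʳ-sum (size X ∸ 1) (⟦_⟧ ∘ X) ⟨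
    size X * (size X ∸ 1)                    ∎
    where
    open ≤-Reasoning
    row : ∀ x → ⟦ X x ⟧ * degreeIn X x ≤ ⟦ X x ⟧ * (size X ∸ 1)
    row x with X x in Xx
    ... | true  = *-monoʳ-≤ 1 (m+n≤o⇒m≤o∸n (degreeIn X x) (subst (_≤ size X) (+-comm 1 _) (degreeIn<size X Xx)))
    ... | false = z≤n

  2∣e-self : ∀ X → 2 ∣ e X X
  2∣e-self X = 2∣∑∑-symmetric (λ x y → ⟦ X x ∧ adj F x y ∧ X y ⟧)
    (λ x y → cong ⟦_⟧ (edge-reverse X X x y))
    (λ x → trans (cong (λ b → ⟦ X x ∧ b ∧ X x ⟧) (irrefl F x)) (cong ⟦_⟧ (∧-zeroʳ (X x))))

  ∂ : VertexSet n → ℕ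
  ∂ X = e X (∁ X)

  ∂-cong : ∀ {X Y} → X ≗ Y → ∂ X ≡ ∂ Y
  ∂-cong X≗Y = e-cong X≗Y (cong not ∘ X≗Y)

  ∂-∁ : ∀ X → ∂ (∁ X) ≡ ∂ X
  ∂-∁ X = trans (e-congʳ (∁ X) (not-involutive ∘ X)) (e-comm (∁ X) X)

  ∂-∩ : ∀ X Y → ∂ (X ∩ Y) ≡ e (X ∩ Y) (X ∖ Y) + e (X ∩ Y) (∁ X)
  ∂-∩ X Y = trans (e-splitʳ (X ∩ Y) (∁ (X ∩ Y)) X)
                  (cong₂ _+_ (e-congʳ (X ∩ Y) (λ i → not[a∧b]∧a (X i) (Y i)))
                             (e-congʳ (X ∩ Y) (λ i → not[a∧b]∧not[a] (X i) (Y i))))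

  ∂-∖ : ∀ X Y → ∂ (X ∖ Y) ≡ e (X ∖ Y) (X ∩ Y) + e (X ∖ Y) (∁ X)
  ∂-∖ X Y = trans (e-splitʳ (X ∖ Y) (∁ (X ∖ Y)) X)
                  (cong₂ _+_ (e-congʳ (X ∖ Y) (λ i → not[a∧not[b]]∧a (X i) (Y i)))
                             (e-congʳ (X ∖ Y) (λ i → not[a∧b]∧not[a] (X i) (not (Y i)))))

  ∂-split : ∀ X Y → ∂ X + 2 * e (X ∩ Y) (X ∖ Y) ≡ ∂ (X ∩ Y) + ∂ (X ∖ Y)
  ∂-split X Y = begin
    ∂ X + 2 * e I P                               ≡⟨ cong (_+ 2 * e I P) (e-splitˡ X Y (∁ X)) ⟩
    (e I (∁ X) + e P (∁ X)) + 2 * e I P           ≡⟨ rearrange (e I (∁ X)) (e P (∁ X)) (e I P) ⟩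
    (e I P + e I (∁ X)) + (e I P + e P (∁ X))     ≡⟨ cong (λ c → (e I P + e I (∁ X)) + (c + e P (∁ X))) (e-comm I P) ⟩
    (e I P + e I (∁ X)) + (e P I + e P (∁ X))     ≡⟨ cong₂ _+_ (∂-∩ X Y) (∂-∖ X Y) ⟨
    ∂ I + ∂ P                                     ∎
    where
    open ≡-Reasoning
    I P : VertexSet n
    I = X ∩ Y
    P = X ∖ Y
    rearrange : ∀ a b p → (a + b) + 2 * p ≡ (p + a) + (p + b)
    rearrange = solve-∀

  ∂-posimodular : ∀ X Y → ∂ X + ∂ Y ≡ ∂ (X ∖ Y) + ∂ (Y ∖ X) + 2 * e (X ∩ Y) (∁ (X ∪ Y))
  ∂-posimodular X Y = +-cancelʳ-≡ (2 * e I P + 2 * e I Q) _ _ (begin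
    ∂ X + ∂ Y + (2 * e I P + 2 * e I Q)            ≡⟨ interchange (∂ X) (∂ Y) (2 * e I P) (2 * e I Q) ⟩
    (∂ X + 2 * e I P) + (∂ Y + 2 * e I Q)          ≡⟨ cong₂ _+_ (∂-split X Y) ∂Y-split ⟩
    (∂ I + ∂ P) + (∂ I + ∂ Q)                      ≡⟨ cong (λ c → (c + ∂ P) + (c + ∂ Q)) ∂I ⟩
    (e I P + (e I Q + e I O) + ∂ P) + (e I P + (e I Q + e I O) + ∂ Q)
                                                   ≡⟨ rearrange (e I P) (e I Q) (e I O) (∂ P) (∂ Q) ⟩
    ∂ P + ∂ Q + 2 * e I O + (2 * e I P + 2 * e I Q) ∎)
    where
    open ≡-Reasoning
    I P Q O : VertexSet n
    I = X ∩ Y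
    P = X ∖ Y
    Q = Y ∖ X
    O = ∁ (X ∪ Y)
    Y∩X≗I : Y ∩ X ≗ I
    Y∩X≗I i = ∧-comm (Y i) (X i)
    ∂Y-split : ∂ Y + 2 * e I Q ≡ ∂ I + ∂ Q
    ∂Y-split = subst₂ (λ p i → ∂ Y + 2 * p ≡ i + ∂ Q)
                      (e-cong Y∩X≗I (λ _ → refl)) (∂-cong Y∩X≗I) (∂-split Y X)
    ∂I : ∂ I ≡ e I P + (e I Q + e I O)
    ∂I = trans (∂-∩ X Y) (cong (e I P +_) (trans (e-splitʳ I (∁ X) Y)
           (cong₂ _+_ (e-congʳ I (λ i → ∧-comm (not (X i)) (Y i)))
                      (e-congʳ I (λ i → not[a]∧not[b] (X i) (Y i))))))
    interchange : ∀ a b c d → a + b + (c + d) ≡ (a + c) + (b + d)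
    interchange = solve-∀
    rearrange : ∀ p q o a b → (p + (q + o) + a) + (p + (q + o) + b) ≡ a + b + 2 * o + (2 * p + 2 * q)
    rearrange = solve-∀

Δ-cases : ∀ d → (2 ∣ d × Δ d ≡ d + 2) ⊎ Δ d ≡ d + 1
Δ-cases d with d % 2 in d%2
... | zero  = inj₁ (m%n≡0⇒n∣m d 2 d%2 , refl)
... | suc _ = inj₂ refl

Δ≤d+2 : ∀ d → Δ d ≤ d + 2
Δ≤d+2 d with Δ-cases d
... | inj₁ (_ , Δ≡d+2) = ≤-reflexive Δ≡d+2
... | inj₂ Δ≡d+1       = ≤-trans (≤-reflexive Δ≡d+1) (+-monoʳ-≤ d (s≤s z≤n))

even-gap : ∀ {m n} → 2 ∣ m → 2 ∣ n → m < n → m + 2 ≤ n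
even-gap {m} (divides p refl) (divides q refl) 2p<2q = begin
  p * 2 + 2   ≡⟨ +-comm (p * 2) 2 ⟩
  suc p * 2   ≤⟨ *-monoˡ-≤ 2 (*-cancelʳ-< 2 p q 2p<2q) ⟩
  q * 2       ∎
  where open ≤-Reasoning

module _ {n d : ℕ} {F : Graph n} (regular : Regular d F) where

  open Edges F

  degree-split : ∀ X x → d ≡ degreeIn X x + degreeIn (∁ X) x
  degree-split X x = trans (≡.sym (regular x)) (trans (count≡size (adj F x)) (size-split (adj F x) X))

  degreeIn-all : ∀ x → degreeIn (λ _ → true) x ≡ d
  degreeIn-all x = trans (size-cong (∧-identityʳ ∘ adj F x)) (trans (≡.sym (count≡size (adj F x))) (regular x))

  handshake : ∀ X → d * size X ≡ e X X + ∂ X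
  handshake X = begin
    d * size X                                     ≡⟨ *-comm d (size X) ⟩
    size X * d                                     ≡⟨ *-distribʳ-sum d (⟦_⟧ ∘ X) ⟩
    ∑[ x < n ] (⟦ X x ⟧ * d)                       ≡⟨ sum-cong-≗ (λ x → cong (⟦ X x ⟧ *_) (degreeIn-all x)) ⟨
    ∑[ x < n ] (⟦ X x ⟧ * degreeIn (λ _ → true) x) ≡⟨ e-by-rows X (λ _ → true) ⟨
    e X (λ _ → true)                               ≡⟨ e-splitʳ X (λ _ → true) X ⟩
    e X X + ∂ X                                    ∎
    where open ≡-Reasoning

  ∂-singleton : ∀ X → size X ≡ 1 → ∂ X ≡ d
  ∂-singleton X |X|≡1 = begin
    ∂ X              ≡⟨ cong (_+ ∂ X) e[X,X]≡0 ⟨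
    e X X + ∂ X      ≡⟨ handshake X ⟨
    d * size X       ≡⟨ cong (d *_) |X|≡1 ⟩
    d * 1            ≡⟨ *-identityʳ d ⟩
    d                ∎
    where
    open ≡-Reasoning
    e[X,X]≡0 : e X X ≡ 0
    e[X,X]≡0 = n≤0⇒n≡0 (subst (λ k → e X X ≤ k * (k ∸ 1)) |X|≡1 (e-self-bound X))

  2∣∂ : ∀ X → 2 ∣ d → 2 ∣ ∂ X
  2∣∂ X 2∣d = ∣m+n∣m⇒∣n (subst (2 ∣_) (handshake X) (∣m⇒∣m*n (size X) 2∣d)) (2∣e-self X)

  d≤degreeIn⇒degreeIn∁≡0 : ∀ X x → d ≤ degreeIn X x → degreeIn (∁ X) x ≡ 0
  d≤degreeIn⇒degreeIn∁≡0 X x d≤ = n≤0⇒n≡0 (+-cancelˡ-≤ (degreeIn X x) _ 0 (begin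
    degreeIn X x + degreeIn (∁ X) x   ≡⟨ degree-split X x ⟨
    d                                 ≤⟨ d≤ ⟩
    degreeIn X x                      ≡⟨ +-identityʳ _ ⟨
    degreeIn X x + 0                  ∎))
    where open ≤-Reasoning

  -- Only boundary vertices are counted, but a vertex of full degree inside S has no neighbour outside.
  edgeBoundarySize≡∂ : ∀ S → edgeBoundarySize F d (induced F S) ≡ ∂ (lookup S)
  edgeBoundarySize≡∂ S = begin
    edgeBoundarySize F d (induced F S)                      ≡⟨ sum-map-allFin (λ x → contribution (lookup S x) x) ⟩
    ∑[ x < n ] contribution (lookup S x) x                  ≡⟨ sum-cong-≗ (λ x → boundary-row x (lookup S x)) ⟩
    ∑[ x < n ] (⟦ lookup S x ⟧ * degreeIn (∁ (lookup S)) x) ≡⟨ e-by-rows (lookup S) (∁ (lookup S)) ⟨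
    ∂ (lookup S)                                            ∎
    where
    open ≡-Reasoning
    contribution : Bool → Fin n → ℕ
    contribution b x = if b ∧ (count (λ y → b ∧ lookup S y ∧ adj F x y) <ᵇ d)
                       then count (λ y → adj F x y ∧ not (lookup S y)) else 0
    boundary-row : ∀ x b → contribution b x ≡ ⟦ b ⟧ * degreeIn (∁ (lookup S)) x
    boundary-row x false = refl
    boundary-row x true with count (λ y → lookup S y ∧ adj F x y) <ᵇ d in lt
    ... | true  = trans (count≡size (λ y → adj F x y ∧ not (lookup S y))) (≡.sym (+-identityʳ _))
    ... | false = ≡.sym (trans (+-identityʳ _) (d≤degreeIn⇒degreeIn∁≡0 (lookup S) x d≤))
      where
      d≤ : d ≤ degreeIn (lookup S) x
      d≤ = subst (d ≤_) (trans (count≡size (λ y → lookup S y ∧ adj F x y))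
                                (size-cong (λ y → ∧-comm (lookup S y) (adj F x y))))
                 (≮⇒≥ (λ c<d → subst T lt (<⇒<ᵇ c<d)))

  module _ (3≤d : 3 ≤ d) (sparse : LocallySparse d F) where

    -- Two vertices span at most one edge, so for |X| = 2 already ∂ X ≥ 2d - 2 > d.
    d<∂ : ∀ X → 2 ≤ size X → size X ≤ n ∸ 3 → d < ∂ X
    d<∂ X 2≤|X| |X|≤n∸3 with 3 ≤? size X
    ... | yes 3≤|X| = subst (d <_) (trans (edgeBoundarySize≡∂ (tabulate X)) (∂-cong (lookup∘tabulate X)))
                        (sparse (induced F (tabulate X)) (subst (3 ≤_) |X|≡count 3≤|X|)
                                                         (subst (_≤ n ∸ 3) |X|≡count |X|≤n∸3))
      where
      |X|≡count : size X ≡ count X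
      |X|≡count = ≡.sym (count≡size X)
    ... | no 3≰|X| = +-cancelˡ-≤ 2 (suc d) (∂ X) (begin
      2 + suc d             ≡⟨ +-comm 3 d ⟩
      d + 3                 ≤⟨ +-monoʳ-≤ d 3≤d ⟩
      d + d                 ≡⟨ trans (cong (d +_) (≡.sym (+-identityʳ d))) (*-comm 2 d) ⟩
      d * 2                 ≡⟨ cong (d *_) |X|≡2 ⟨
      d * size X            ≡⟨ handshake X ⟩
      e X X + ∂ X           ≤⟨ +-monoˡ-≤ (∂ X) (subst (λ k → e X X ≤ k * (k ∸ 1)) |X|≡2 (e-self-bound X)) ⟩
      2 + ∂ X               ∎)
      where
      open ≤-Reasoning
      |X|≡2 : size X ≡ 2
      |X|≡2 = ≤-antisym (≤-pred (≰⇒> 3≰|X|)) 2≤|X|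

    Δ≤∂ : ∀ X → 2 ≤ size X → size X ≤ n ∸ 3 → Δ d ≤ ∂ X
    Δ≤∂ X 2≤|X| |X|≤n∸3 with Δ-cases d
    ... | inj₁ (2∣d , Δ≡d+2) =
      subst (_≤ ∂ X) (≡.sym Δ≡d+2) (even-gap 2∣d (2∣∂ X 2∣d) (d<∂ X 2≤|X| |X|≤n∸3))
    ... | inj₂ Δ≡d+1         = subst (_≤ ∂ X) (≡.sym (trans Δ≡d+1 (+-comm d 1))) (d<∂ X 2≤|X| |X|≤n∸3)

    record Admissible (v : ℕ) (x y : Fin n) (X : VertexSet n) : Set where
      field
        ∂≡Δ    : ∂ X ≡ Δ d
        size≡v : size X ≡ v
        ∋x     : X x ≡ true
        ∌y     : X y ≡ false
    open Admissible

    closed⇒admissible : ∀ (S : Subset n) {v x y} → Closed F d S → ∣ S ∣ ≡ v →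
                        lookup S x ≡ true → lookup S y ≡ false → Admissible v x y (lookup S)
    closed⇒admissible S closed |S|≡v Sx Sy = record
      { ∂≡Δ    = trans (≡.sym (edgeBoundarySize≡∂ S)) closed
      ; size≡v = trans (≡.sym (∣∣≡size S)) |S|≡v
      ; ∋x     = Sx
      ; ∌y     = Sy
      }

    admissible-∁ : ∀ {v x y} {X : VertexSet n} → Admissible v x y X → Admissible (n ∸ v) y x (∁ X)
    admissible-∁ {X = X} adm = record
      { ∂≡Δ    = trans (∂-∁ X) (∂≡Δ adm)
      ; size≡v = trans (size-∁ X) (cong (n ∸_) (size≡v adm))
      ; ∋x     = cong not (∌y adm)
      ; ∌y     = cong not (∋x adm)
      }

    module _ {x y : Fin n} (x~y : adj F x y ≡ true) {v : ℕ} (3≤v : 3 ≤ v) (v≤n∸3 : v ≤ n ∸ 3) where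

      e[∩,∁∪]-positive : ∀ {X Y : VertexSet n} → Admissible v x y X → Admissible v x y Y →
                         1 ≤ e (X ∩ Y) (∁ (X ∪ Y))
      e[∩,∁∪]-positive {X} {Y} admX admY =
        e-positive (X ∩ Y) (∁ (X ∪ Y)) (cong₂ _∧_ (∋x admX) (∋x admY)) x~y
                   (cong₂ (λ a b → not (a ∨ b)) (∌y admX) (∌y admY))

      size∖≤1 : ∀ {X Y : VertexSet n} → Admissible v x y X → Admissible v x y Y → size (X ∖ Y) ≤ 1
      size∖≤1 {X} {Y} admX admY with 2 ≤? size (X ∖ Y)
      ... | no  2≰|X∖Y| = ≤-pred (≰⇒> 2≰|X∖Y|)
      ... | yes 2≤|X∖Y| = contradiction (begin-strict
        Δ d + Δ d                          <⟨ m<m+n (Δ d + Δ d) (≤-trans (s≤s z≤n) (*-monoʳ-≤ 2 1≤e[I,O])) ⟩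
        Δ d + Δ d + 2 * e I O              ≤⟨ +-monoˡ-≤ (2 * e I O) (+-mono-≤ Δ≤∂[X∖Y] Δ≤∂[Y∖X]) ⟩
        ∂ (X ∖ Y) + ∂ (Y ∖ X) + 2 * e I O  ≡⟨ ∂-posimodular X Y ⟨
        ∂ X + ∂ Y                          ≡⟨ cong₂ _+_ (∂≡Δ admX) (∂≡Δ admY) ⟩
        Δ d + Δ d                          ∎) (<-irrefl refl)
        where
        open ≤-Reasoning
        I O : VertexSet n
        I = X ∩ Y
        O = ∁ (X ∪ Y)
        1≤e[I,O] : 1 ≤ e I O
        1≤e[I,O] = e[∩,∁∪]-positive admX admY
        2≤|Y∖X| : 2 ≤ size (Y ∖ X)
        2≤|Y∖X| = subst (2 ≤_) (size∖-swap X Y (trans (size≡v admX) (≡.sym (size≡v admY)))) 2≤|X∖Y|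
        Δ≤∂[X∖Y] : Δ d ≤ ∂ (X ∖ Y)
        Δ≤∂[X∖Y] = Δ≤∂ (X ∖ Y) 2≤|X∖Y| (≤-trans (size∖≤size X Y) (subst (_≤ n ∸ 3) (≡.sym (size≡v admX)) v≤n∸3))
        Δ≤∂[Y∖X] : Δ d ≤ ∂ (Y ∖ X)
        Δ≤∂[Y∖X] = Δ≤∂ (Y ∖ X) 2≤|Y∖X| (≤-trans (size∖≤size Y X) (subst (_≤ n ∸ 3) (≡.sym (size≡v admY)) v≤n∸3))

      size∖≡1 : ∀ {X Y : VertexSet n} → Admissible v x y X → Admissible v x y Y → ¬ X ≗ Y → size (X ∖ Y) ≡ 1
      size∖≡1 {X} {Y} admX admY X≉Y with size (X ∖ Y) in |X∖Y| | size∖≤1 admX admY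
      ... | zero        | _      = contradiction (size∖≡0⇒≗ X Y (trans (size≡v admX) (≡.sym (size≡v admY))) |X∖Y|) X≉Y
      ... | suc zero    | _      = refl
      ... | suc (suc _) | s≤s ()

      Δ≡d+e[∩,∁∪] : ∀ {X Y : VertexSet n} → Admissible v x y X → Admissible v x y Y → ¬ X ≗ Y →
                    Δ d ≡ d + e (X ∩ Y) (∁ (X ∪ Y))
      Δ≡d+e[∩,∁∪] {X} {Y} admX admY X≉Y = *-cancelˡ-≡ (Δ d) (d + e I O) 2 (begin
        2 * Δ d                            ≡⟨ double (Δ d) ⟨
        Δ d + Δ d                          ≡⟨ cong₂ _+_ (∂≡Δ admX) (∂≡Δ admY) ⟨
        ∂ X + ∂ Y                          ≡⟨ ∂-posimodular X Y ⟩
        ∂ (X ∖ Y) + ∂ (Y ∖ X) + 2 * e I O  ≡⟨ cong (_+ 2 * e I O) (cong₂ _+_ ∂[X∖Y] ∂[Y∖X]) ⟩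
        d + d + 2 * e I O                  ≡⟨ rearrange d (e I O) ⟩
        2 * (d + e I O)                    ∎)
        where
        open ≡-Reasoning
        I O : VertexSet n
        I = X ∩ Y
        O = ∁ (X ∪ Y)
        ∂[X∖Y] : ∂ (X ∖ Y) ≡ d
        ∂[X∖Y] = ∂-singleton (X ∖ Y) (size∖≡1 admX admY X≉Y)
        ∂[Y∖X] : ∂ (Y ∖ X) ≡ d
        ∂[Y∖X] = ∂-singleton (Y ∖ X) (size∖≡1 admY admX (≉-sym X≉Y))
        double : ∀ a → a + a ≡ 2 * a
        double = solve-∀
        rearrange : ∀ a b → a + a + 2 * b ≡ 2 * (a + b)
        rearrange = solve-∀

      2≤e[∩,∖] : ∀ {X Y : VertexSet n} → Admissible v x y X → Admissible v x y Y → ¬ X ≗ Y →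
                 2 ≤ e (X ∩ Y) (X ∖ Y)
      2≤e[∩,∖] {X} {Y} admX admY X≉Y = half (+-cancelˡ-≤ (Δ d) 3 _ (begin
        Δ d + 3                        ≤⟨ +-mono-≤ (Δ≤∂ (X ∩ Y) 2≤|X∩Y| |X∩Y|≤n∸3) 3≤d ⟩
        ∂ (X ∩ Y) + d                  ≡⟨ cong (∂ (X ∩ Y) +_) (∂-singleton (X ∖ Y) |X∖Y|≡1) ⟨
        ∂ (X ∩ Y) + ∂ (X ∖ Y)          ≡⟨ ∂-split X Y ⟨
        ∂ X + 2 * e (X ∩ Y) (X ∖ Y)    ≡⟨ cong (_+ 2 * e (X ∩ Y) (X ∖ Y)) (∂≡Δ admX) ⟩
        Δ d + 2 * e (X ∩ Y) (X ∖ Y)    ∎))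
        where
        open ≤-Reasoning
        |X∖Y|≡1 : size (X ∖ Y) ≡ 1
        |X∖Y|≡1 = size∖≡1 admX admY X≉Y
        |X∩Y|+1≡v : size (X ∩ Y) + 1 ≡ v
        |X∩Y|+1≡v = trans (cong (size (X ∩ Y) +_) (≡.sym |X∖Y|≡1)) (trans (≡.sym (size-split X Y)) (size≡v admX))
        2≤|X∩Y| : 2 ≤ size (X ∩ Y)
        2≤|X∩Y| = +-cancelʳ-≤ 1 2 _ (subst (3 ≤_) (≡.sym |X∩Y|+1≡v) 3≤v)
        |X∩Y|≤n∸3 : size (X ∩ Y) ≤ n ∸ 3
        |X∩Y|≤n∸3 = ≤-trans (m≤m+n _ 1) (subst (_≤ n ∸ 3) (≡.sym |X∩Y|+1≡v) v≤n∸3)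
        half : ∀ {p} → 3 ≤ 2 * p → 2 ≤ p
        half {zero}        ()
        half {suc zero}    (s≤s (s≤s ()))
        half {suc (suc p)} _ = s≤s (s≤s z≤n)

      -- With A ∩ B = C ∩ A, the set C ∖ A lies outside A ∪ B and receives at least two edges from A ∩ B.
      no-sunflower : ∀ {A B C : VertexSet n} → Admissible v x y A → Admissible v x y B → Admissible v x y C →
                     ¬ A ≗ B → ¬ C ≗ A → Sunflower A B C → ⊥
      no-sunflower {A} {B} {C} admA admB admC A≉B C≉A (A∩B⊆C , B∩C⊆A , C∩A⊆B) =
        <-irrefl refl (+-cancelˡ-≤ d 3 2 (begin
          d + 3                                   ≤⟨ +-monoʳ-≤ d (+-mono-≤ (2≤e[∩,∖] admC admA C≉A) 1≤e[I,O∖C]) ⟩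
          d + (e (C ∩ A) (C ∖ A) + e I (O ∖ C))   ≡⟨ cong (λ k → d + (k + e I (O ∖ C))) e[I,O∩C] ⟨
          d + (e I (O ∩ C) + e I (O ∖ C))         ≡⟨ cong (d +_) (e-splitʳ I O C) ⟨
          d + e I O                               ≡⟨ Δ≡d+e[∩,∁∪] admA admB A≉B ⟨
          Δ d                                     ≤⟨ Δ≤d+2 d ⟩
          d + 2                                   ∎))
        where
        open ≤-Reasoning
        I O : VertexSet n
        I = A ∩ B
        O = ∁ (A ∪ B)
        I≗C∩A : I ≗ C ∩ A
        I≗C∩A i = pointwise (A i) (B i) (C i) (A∩B⊆C {i}) (C∩A⊆B {i})
          where
          pointwise : ∀ a b c → (a ∧ b ≡ true → c ≡ true) → (c ∧ a ≡ true → b ≡ true) → a ∧ b ≡ c ∧ a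
          pointwise false b     c     _ _ = ≡.sym (∧-zeroʳ c)
          pointwise true  true  true  _ _ = refl
          pointwise true  false false _ _ = refl
          pointwise true  true  false h _ = ≡.sym (h refl)
          pointwise true  false true  _ h = h refl
        O∩C≗C∖A : O ∩ C ≗ C ∖ A
        O∩C≗C∖A i = pointwise (A i) (B i) (C i) (B∩C⊆A {i})
          where
          pointwise : ∀ a b c → (b ∧ c ≡ true → a ≡ true) → not (a ∨ b) ∧ c ≡ c ∧ not a
          pointwise true  b     c     _ = ≡.sym (∧-zeroʳ c)
          pointwise false false c     _ = ≡.sym (∧-identityʳ c)
          pointwise false true  false _ = refl
          pointwise false true  true  h = h refl
        e[I,O∩C] : e I (O ∩ C) ≡ e (C ∩ A) (C ∖ A)
        e[I,O∩C] = e-cong I≗C∩A O∩C≗C∖A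
        1≤e[I,O∖C] : 1 ≤ e I (O ∖ C)
        1≤e[I,O∖C] = e-positive I (O ∖ C) (cong₂ _∧_ (∋x admA) (∋x admB)) x~y
          (trans (cong₂ (λ a b → not (a ∨ b) ∧ not (C y)) (∌y admA) (∌y admB)) (cong not (∌y admC)))

    -- The complements satisfy the same hypotheses, with x and y exchanged and v replaced by n - v.
    at-most-two-admissible : ∀ {x y} → adj F x y ≡ true → ∀ {v} → 3 ≤ v → v ≤ n ∸ 3 →
                             ∀ {A B C} → Admissible v x y A → Admissible v x y B → Admissible v x y C →
                             ¬ A ≗ B → ¬ A ≗ C → ¬ B ≗ C → ⊥
    at-most-two-admissible {x} {y} x~y {v} 3≤v v≤n∸3 {A} {B} {C} admA admB admC A≉B A≉C B≉C =
      [ no-sunflower x~y 3≤v v≤n∸3 admA admB admC A≉B (≉-sym A≉C)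
      , no-sunflower (trans (sym F y x) x~y) 3≤n∸v (∸-monoʳ-≤ n 3≤v)
          (admissible-∁ admA) (admissible-∁ admB) (admissible-∁ admC) (∁-≉ A≉B) (∁-≉ (≉-sym A≉C))
      ] (sunflower-or-cosunflower A B C
           (|∖|≡1 admA admB A≉B) (|∖|≡1 admA admC A≉C) (|∖|≡1 admB admC B≉C)
           (|∖|≡1 admB admA (≉-sym A≉B)) (|∖|≡1 admC admA (≉-sym A≉C)) (|∖|≡1 admC admB (≉-sym B≉C)))
      where
      |∖|≡1 : ∀ {X Y : VertexSet n} → Admissible v x y X → Admissible v x y Y → ¬ X ≗ Y → size (X ∖ Y) ≡ 1
      |∖|≡1 = size∖≡1 x~y 3≤v v≤n∸3
      3≤n : 3 ≤ n
      3≤n = ≤-trans 3≤v (≤-trans v≤n∸3 (m∸n≤m n 3))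
      3≤n∸v : 3 ≤ n ∸ v
      3≤n∸v = m+n≤o⇒m≤o∸n 3 (subst (_≤ n) (+-comm v 3) (m≤o∸n⇒m+n≤o v 3≤n v≤n∸3))

claim2 : (d n : ℕ) → 3 ≤ d → (F : Graph n) → Regular d F → LocallySparse d F →
         (x y : Fin n) → adj F x y ≡ true →
         (v : ℕ) → 3 ≤ v → v ≤ n ∸ 3 →
         (S₁ S₂ S₃ : Subset n) →
         Closed F d S₁ → ∣ S₁ ∣ ≡ v → lookup S₁ x ≡ true → lookup S₁ y ≡ false →
         Closed F d S₂ → ∣ S₂ ∣ ≡ v → lookup S₂ x ≡ true → lookup S₂ y ≡ false →
         Closed F d S₃ → ∣ S₃ ∣ ≡ v → lookup S₃ x ≡ true → lookup S₃ y ≡ false →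
         S₁ ≢ S₂ → S₁ ≢ S₃ → S₂ ≢ S₃ → ⊥
claim2 d n 3≤d F regular sparse x y x~y v 3≤v v≤n∸3 S₁ S₂ S₃
       c₁ s₁ x₁ y₁ c₂ s₂ x₂ y₂ c₃ s₃ x₃ y₃ S₁≢S₂ S₁≢S₃ S₂≢S₃ =
  at-most-two-admissible regular 3≤d sparse x~y 3≤v v≤n∸3
    (closed⇒admissible regular 3≤d sparse S₁ c₁ s₁ x₁ y₁)
    (closed⇒admissible regular 3≤d sparse S₂ c₂ s₂ x₂ y₂)
    (closed⇒admissible regular 3≤d sparse S₃ c₃ s₃ x₃ y₃)
    (≢⇒≉ S₁≢S₂) (≢⇒≉ S₁≢S₃) (≢⇒≉ S₂≢S₃)
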